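{- Let $(N,T,f)$ be a linear game ladder and $i,j,k\in N$. If $i\succ j$ and $j\sim k$, then $i\succ k$. Also, if $i\sim j$ and $j\succ k$, then $i\succ k$.
   Context: A game ladder is a triple $(N,T,f)$ where $N=\{1,\dots,n\}$ is a non-empty finite set of players, $T=\{1,\dots,m\}$ with $m\ge 2$ is an ordered set of positions (higher index = more important position), and $f:T^N\to\mathbb{R}$ is monotonic: for all $x,z\in T^N$ with $x\le z$ componentwise, $f(x)\le f(z)$. For $p\in N$, $e^p$ denotes the $p$-th unit vector. For players $p,q$ and positions $r>s$ in $T$, write $p\succeq_{(r,s)}q$ if for every $x\in T^N$ with $x_p=x_q=s$ one has $f(x+(r-s)e^p)\ge f(x+(r-s)e^q)$. Write $p\succeq q$ if $p\succeq_{(r,s)}q$ for all $r,s\in T$ with $r>s$; $p\succ q$ means $p\succeq q$ and not $q\succeq p$; $p\sim q$ means $p\succeq q$ and $q\succeq p$. The game ladder is linear if $\succeq$ is complete, i.e. for all $p,q\in N$, $p\succeq q$ or $q\succeq p$. -}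

module Defs where

open import Level using (Level; _⊔_)
open import Data.Nat using (ℕ; suc)
open import Data.Fin using (Fin; _≟_) renaming (_≤_ to _≤ᶠ_; _<_ to _<ᶠ_)
open import Data.Bool using (if_then_else_)
open import Data.Product using (_×_)
open import Relation.Nullary using (¬_)
open import Relation.Nullary.Decidable using (⌊_⌋)
open import Relation.Binary.PropositionalEquality using (_≡_)
open import Relation.Binary.Bundles using (TotalOrder)

-- Players N = Fin n, positions T = Fin m (index 0 = least important).
-- A position profile x ∈ T^N is a function Fin n → Fin m.
Profile : ℕ → ℕ → Set
Profile n m = Fin n → Fin m

_≤ᴾ_ : ∀ {n m} → Profile n m → Profile n m → Set
x ≤ᴾ z = ∀ p → x p ≤ᶠ z p

-- x with coordinate p replaced by r.  When x p = s this is exactly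
-- x + (r - s) e^p.
set : ∀ {n m} → Profile n m → Fin n → Fin m → Profile n m
set x p r q = if ⌊ q ≟ p ⌋ then r else x q

module Ladder {c ℓ₁ ℓ₂ : Level} (O : TotalOrder c ℓ₁ ℓ₂) where
  open TotalOrder O renaming (Carrier to V; _≤_ to _≤ⱽ_)

  Monotonic : ∀ {n m} → (Profile n m → V) → Set (ℓ₂)
  Monotonic {n} {m} f = ∀ (x z : Profile n m) → x ≤ᴾ z → f x ≤ⱽ f z

  Dom : ∀ {n m} → (Profile n m → V) → Fin n → Fin n → Fin m → Fin m → Set ℓ₂
  Dom {n} {m} f p q r s = ∀ (x : Profile n m) → x p ≡ s → x q ≡ s →
                          f (set x q r) ≤ⱽ f (set x p r)

  _⪰[_]_ : ∀ {n m} → Fin n → (Profile n m → V) → Fin n → Set ℓ₂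
  _⪰[_]_ {n} {m} p f q = ∀ (r s : Fin m) → s <ᶠ r → Dom f p q r s

  _≻[_]_ : ∀ {n m} → Fin n → (Profile n m → V) → Fin n → Set ℓ₂
  p ≻[ f ] q = (p ⪰[ f ] q) × ¬ (q ⪰[ f ] p)

  _∼[_]_ : ∀ {n m} → Fin n → (Profile n m → V) → Fin n → Set ℓ₂
  p ∼[ f ] q = (p ⪰[ f ] q) × (q ⪰[ f ] p)

  Linear : ∀ {n m} → (Profile n m → V) → Set ℓ₂
  Linear {n} f = ∀ (p q : Fin n) → (p ⪰[ f ] q) ⊎' (q ⪰[ f ] p)
    where open import Data.Sum using () renaming (_⊎_ to _⊎'_)

module Submission where

-- If j ∼ k then f is invariant under exchanging the positions of j and k: for
-- x j < x k this is k ⪰ j read at (x k, x j), for x j > x k it is j ⪰ k.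
-- Relabelling players by any injection leaving f invariant preserves ⪰, and
-- the transposition of j and k maps i ⪰ j to i ⪰ k (and j ⪰ i to k ⪰ i)
-- whenever i ∉ {j, k}; the remaining cases are trivial.  So ⪰ respects ∼ on
-- both sides, which gives both claims.

open import Defs
open import Level using (Level)
open import Data.Nat using (ℕ; _≤_)
open import Data.Fin using (Fin; _≟_) renaming (_<_ to _<ᶠ_)
open import Data.Fin.Properties using (≤-reflexive; <-cmp; <-irrefl)
open import Data.Fin.Permutation.Components using (transpose; transpose-inverse)
open import Data.Product using (_×_; _,_; proj₁; proj₂)
open import Function using (_∘_; case_of_)
open import Function.Definitions using (Injective)
open import Relation.Nullary using (yes; no; contradiction)
open import Relation.Binary using (tri<; tri≈; tri>)
open import Relation.Binary.PropositionalEquality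
  using (_≡_; _≢_; _≗_; refl; sym; trans; cong; subst₂)
open import Relation.Binary.Bundles using (TotalOrder)

module _ {n m : ℕ} where

  set-≡ : ∀ (x : Profile n m) p r → set x p r p ≡ r
  set-≡ x p r with p ≟ p
  ... | yes _   = refl
  ... | no p≢p  = contradiction refl p≢p

  set-≢ : ∀ (x : Profile n m) p r {q} → q ≢ p → set x p r q ≡ x q
  set-≢ x p r {q} q≢p with q ≟ p
  ... | yes q≡p = contradiction q≡p q≢p
  ... | no _    = refl

  set-restore : ∀ (x : Profile n m) p u → set (set x p u) p (x p) ≗ x
  set-restore x p u q = case (q ≟ p) of λ where
    (yes refl) → set-≡ (set x q u) q (x q)
    (no q≢p)   → trans (set-≢ (set x p u) p (x p) q≢p) (set-≢ x p u q≢p)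

  set-∘-injective : ∀ (σ : Fin n → Fin n) → Injective _≡_ _≡_ σ →
                    ∀ (x : Profile n m) p r → set x (σ p) r ∘ σ ≗ set (x ∘ σ) p r
  set-∘-injective σ σ-inj x p r q with q ≟ p
  ... | yes refl = set-≡ x (σ q) r
  ... | no q≢p   = set-≢ x (σ p) r (q≢p ∘ σ-inj)

module _ {n : ℕ} where

  transpose-matchˡ : ∀ (i j : Fin n) → transpose i j i ≡ j
  transpose-matchˡ i j with i ≟ i
  ... | yes _  = refl
  ... | no i≢i = contradiction refl i≢i

  transpose-matchʳ : ∀ (i j : Fin n) → transpose i j j ≡ i
  transpose-matchʳ i j with j ≟ i
  ... | yes j≡i = j≡i
  ... | no _ with j ≟ j
  ...   | yes _  = refl
  ...   | no j≢j = contradiction refl j≢j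

  transpose-mismatch : ∀ (i j : Fin n) {k} → k ≢ i → k ≢ j → transpose i j k ≡ k
  transpose-mismatch i j {k} k≢i k≢j with k ≟ i
  ... | yes k≡i = contradiction k≡i k≢i
  ... | no _ with k ≟ j
  ...   | yes k≡j = contradiction k≡j k≢j
  ...   | no _    = refl

  transpose-comm : ∀ (i j k : Fin n) → transpose i j k ≡ transpose j i k
  transpose-comm i j k = case ((k ≟ i) , (k ≟ j)) of λ where
    (yes refl , _)        → trans (transpose-matchˡ k j) (sym (transpose-matchʳ j k))
    (no _     , yes refl) → trans (transpose-matchʳ i k) (sym (transpose-matchˡ k i))
    (no k≢i   , no k≢j)   → trans (transpose-mismatch i j k≢i k≢j)
                                  (sym (transpose-mismatch j i k≢j k≢i))

  transpose-involutive : ∀ (i j k : Fin n) → transpose i j (transpose i j k) ≡ k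
  transpose-involutive i j k =
    trans (cong (transpose i j) (transpose-comm i j k)) (transpose-inverse i j)

  transpose-injective : ∀ (i j : Fin n) → Injective _≡_ _≡_ (transpose i j)
  transpose-injective i j {k} {l} τk≡τl =
    trans (sym (transpose-involutive i j k))
          (trans (cong (transpose i j) τk≡τl) (transpose-involutive i j l))

  module _ {m : ℕ} (x : Profile n m) (a b : Fin n) where

    ∘-transpose≗set : x ∘ transpose a b ≗ set (set x b (x a)) a (x b)
    ∘-transpose≗set k = case ((k ≟ a) , (k ≟ b)) of λ where
      (yes refl , _)        → trans (cong x (transpose-matchˡ k b))
                                    (sym (set-≡ (set x b (x k)) k (x b)))
      (no k≢a   , yes refl) → trans (cong x (transpose-matchʳ a k))
                                    (sym (trans (set-≢ (set x k (x a)) a (x k) k≢a) (set-≡ x k (x a))))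
      (no k≢a   , no k≢b)   → trans (cong x (transpose-mismatch a b k≢a k≢b))
                                    (sym (trans (set-≢ (set x b (x a)) a (x b) k≢a) (set-≢ x b (x a) k≢b)))

    ∘-transpose≗id : x a ≡ x b → x ∘ transpose a b ≗ x
    ∘-transpose≗id xa≡xb k = case ((k ≟ a) , (k ≟ b)) of λ where
      (yes refl , _)        → trans (cong x (transpose-matchˡ k b)) (sym xa≡xb)
      (no _     , yes refl) → trans (cong x (transpose-matchʳ a k)) xa≡xb
      (no k≢a   , no k≢b)   → cong x (transpose-mismatch a b k≢a k≢b)

module _ {c ℓ₁ ℓ₂ : Level} (O : TotalOrder c ℓ₁ ℓ₂) {n m : ℕ}
         (f : Profile n m → TotalOrder.Carrier O) (mono : Ladder.Monotonic O f) where

  open TotalOrder O using (poset) renaming (_≤_ to _≤ⱽ_; refl to ≤ⱽ-refl)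
  open Ladder O
  open import Relation.Binary.Reasoning.PartialOrder poset

  mono-≗ : ∀ {x y : Profile n m} → x ≗ y → f x ≤ⱽ f y
  mono-≗ x≗y = mono _ _ (λ p → ≤-reflexive (x≗y p))

  ⪰-refl : ∀ p → p ⪰[ f ] p
  ⪰-refl p _ _ _ _ _ _ = ≤ⱽ-refl

  ⪰⇒transpose-≤ : ∀ {a b} → b ⪰[ f ] a → ∀ x → x a <ᶠ x b → f (x ∘ transpose a b) ≤ⱽ f x
  ⪰⇒transpose-≤ {a} {b} b⪰a x xa<xb = begin
    f (x ∘ transpose a b)   ≤⟨ mono-≗ (∘-transpose≗set x a b) ⟩
    f (set y a (x b))       ≤⟨ b⪰a (x b) (x a) xa<xb y (set-≡ x b (x a)) ya≡xa ⟩
    f (set y b (x b))       ≤⟨ mono-≗ (set-restore x b (x a)) ⟩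
    f x                     ∎
    where
    y = set x b (x a)
    ya≡xa : y a ≡ x a
    ya≡xa = set-≢ x b (x a) (λ { refl → <-irrefl refl xa<xb })

  ∼⇒transpose-≤ : ∀ {a b} → a ∼[ f ] b → ∀ x → f (x ∘ transpose a b) ≤ⱽ f x
  ∼⇒transpose-≤ {a} {b} (a⪰b , b⪰a) x with <-cmp (x a) (x b)
  ... | tri< xa<xb _ _ = ⪰⇒transpose-≤ b⪰a x xa<xb
  ... | tri≈ _ xa≡xb _ = mono-≗ (∘-transpose≗id x a b xa≡xb)
  ... | tri> _ _ xb<xa = begin
    f (x ∘ transpose a b)   ≤⟨ mono-≗ (cong x ∘ transpose-comm a b) ⟩
    f (x ∘ transpose b a)   ≤⟨ ⪰⇒transpose-≤ a⪰b x xb<xa ⟩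
    f x                     ∎

  ∼⇒transpose-≥ : ∀ {a b} → a ∼[ f ] b → ∀ x → f x ≤ⱽ f (x ∘ transpose a b)
  ∼⇒transpose-≥ {a} {b} a∼b x = begin
    f x                                       ≤⟨ mono-≗ (sym ∘ cong x ∘ transpose-involutive a b) ⟩
    f (x ∘ transpose a b ∘ transpose a b)     ≤⟨ ∼⇒transpose-≤ a∼b (x ∘ transpose a b) ⟩
    f (x ∘ transpose a b)                     ∎

  ⪰-relabel : ∀ (σ : Fin n → Fin n) → Injective _≡_ _≡_ σ →
              (∀ x → f (x ∘ σ) ≤ⱽ f x) → (∀ x → f x ≤ⱽ f (x ∘ σ)) →
              ∀ {p q} → p ⪰[ f ] q → σ p ⪰[ f ] σ q
  ⪰-relabel σ σ-inj f∘σ≤f f≤f∘σ {p} {q} p⪰q r s s<r x xσp≡s xσq≡s = begin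
    f (set x (σ q) r)       ≤⟨ f≤f∘σ (set x (σ q) r) ⟩
    f (set x (σ q) r ∘ σ)   ≤⟨ mono-≗ (set-∘-injective σ σ-inj x q r) ⟩
    f (set (x ∘ σ) q r)     ≤⟨ p⪰q r s s<r (x ∘ σ) xσp≡s xσq≡s ⟩
    f (set (x ∘ σ) p r)     ≤⟨ mono-≗ (sym ∘ set-∘-injective σ σ-inj x p r) ⟩
    f (set x (σ p) r ∘ σ)   ≤⟨ f∘σ≤f (set x (σ p) r) ⟩
    f (set x (σ p) r)       ∎

  ⪰-transpose : ∀ {a b} → a ∼[ f ] b → ∀ {p q} → p ⪰[ f ] q →
                transpose a b p ⪰[ f ] transpose a b q
  ⪰-transpose {a} {b} a∼b =
    ⪰-relabel (transpose a b) (transpose-injective a b) (∼⇒transpose-≤ a∼b) (∼⇒transpose-≥ a∼b)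

  ⪰-respʳ-∼ : ∀ {a b c} → c ⪰[ f ] a → a ∼[ f ] b → c ⪰[ f ] b
  ⪰-respʳ-∼ {a} {b} {c} c⪰a a∼b = case ((c ≟ a) , (c ≟ b)) of λ where
    (yes refl , _)        → proj₁ a∼b
    (no _     , yes refl) → ⪰-refl c
    (no c≢a   , no c≢b)   → subst₂ (λ p q → p ⪰[ f ] q)
                              (transpose-mismatch a b c≢a c≢b) (transpose-matchˡ a b)
                              (⪰-transpose a∼b c⪰a)

  ⪰-respˡ-∼ : ∀ {a b c} → a ⪰[ f ] c → a ∼[ f ] b → b ⪰[ f ] c
  ⪰-respˡ-∼ {a} {b} {c} a⪰c a∼b = case ((c ≟ a) , (c ≟ b)) of λ where
    (yes refl , _)        → proj₂ a∼b
    (no _     , yes refl) → ⪰-refl c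
    (no c≢a   , no c≢b)   → subst₂ (λ p q → p ⪰[ f ] q)
                              (transpose-matchˡ a b) (transpose-mismatch a b c≢a c≢b)
                              (⪰-transpose a∼b a⪰c)

proposition5 : ∀ {c ℓ₁ ℓ₂ : Level} (O : TotalOrder c ℓ₁ ℓ₂) (n m : ℕ) → 1 ≤ n → 2 ≤ m →
    (f : Profile n m → TotalOrder.Carrier O) →
    Ladder.Monotonic O f → Ladder.Linear O f →
    (i j k : Fin n) →
    ((Ladder._≻[_]_ O i f j × Ladder._∼[_]_ O j f k) → Ladder._≻[_]_ O i f k) ×
    ((Ladder._∼[_]_ O i f j × Ladder._≻[_]_ O j f k) → Ladder._≻[_]_ O i f k)
proposition5 O n m _ _ f mono _ i j k =
  (λ { ((i⪰j , j⋡i) , (j⪰k , k⪰j)) →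
         ⪰-respʳ-∼ O f mono i⪰j (j⪰k , k⪰j) ,
         λ k⪰i → j⋡i (⪰-respˡ-∼ O f mono k⪰i (k⪰j , j⪰k)) }) ,
  (λ { ((i⪰j , j⪰i) , (j⪰k , k⋡j)) →
         ⪰-respˡ-∼ O f mono j⪰k (j⪰i , i⪰j) ,
         λ k⪰i → k⋡j (⪰-respʳ-∼ O f mono k⪰i (i⪰j , j⪰i)) })
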